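{- For every integer $k\ge 3$, there exists a connected semi-symmetric graph of order $4k^2$ with valency $2k(k-1)$. In particular, writing the order as $2n$ and the valency as $d$, the ratio $d/n=(k-1)/k$, which tends to $1$ as $k\to\infty$.
   Context: All graphs are simple and undirected. A graph is semi-symmetric if it is regular and edge-transitive (its automorphism group is transitive on edges) but not vertex-transitive. -}

module Defs where

open import Data.Nat using (ℕ; zero; suc; _+_)
open import Data.Fin using (Fin)
open import Data.Fin.Permutation using (Permutation′; _⟨$⟩ʳ_)
open import Data.Bool using (Bool; true; false; if_then_else_)
open import Data.List using (List; map; allFin)
open import Data.Nat.ListAction using (sum)
open import Data.Product using (Σ; ∃; _×_)
open import Data.Sum using (_⊎_)
open import Relation.Nullary using (¬_)
open import Relation.Binary.PropositionalEquality using (_≡_)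

record Graph (n : ℕ) : Set where
  field
    adj   : Fin n → Fin n → Bool
    sym   : ∀ i j → adj i j ≡ adj j i
    irref : ∀ i → adj i i ≡ false
open Graph public

module _ {n : ℕ} (G : Graph n) where

  degree : Fin n → ℕ
  degree i = sum (map (λ j → if adj G i j then 1 else 0) (allFin n))

  Regular : ℕ → Set
  Regular d = ∀ i → degree i ≡ d

  IsRegular : Set
  IsRegular = ∃ λ d → Regular d

  data Walk : Fin n → Fin n → Set where
    here : ∀ {u} → Walk u u
    step : ∀ {u w v} → adj G u w ≡ true → Walk w v → Walk u v

  Connected : Set
  Connected = ∀ u v → Walk u v

  IsAutomorphism : Permutation′ n → Set
  IsAutomorphism σ = ∀ i j → adj G (σ ⟨$⟩ʳ i) (σ ⟨$⟩ʳ j) ≡ adj G i j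

  VertexTransitive : Set
  VertexTransitive = ∀ u v → Σ (Permutation′ n) λ σ → IsAutomorphism σ × (σ ⟨$⟩ʳ u ≡ v)

  EdgeTransitive : Set
  EdgeTransitive = ∀ u v x y → adj G u v ≡ true → adj G x y ≡ true →
    Σ (Permutation′ n) λ σ → IsAutomorphism σ ×
      (((σ ⟨$⟩ʳ u ≡ x) × (σ ⟨$⟩ʳ v ≡ y)) ⊎ ((σ ⟨$⟩ʳ u ≡ y) × (σ ⟨$⟩ʳ v ≡ x)))

  SemiSymmetric : Set
  SemiSymmetric = IsRegular × EdgeTransitive × ¬ VertexTransitive

-- The graph is bipartite with parts {α s x i} and {β t p q}, where s, t ∈ Fin 2 and
-- x, i, p, q ∈ Fin k, and α s x i ~ β t p q iff x differs from coordinate s of (p , q);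
-- the coordinates i and t merely make copies.
-- Swapping the two coordinates, permuting copies and relabelling each coordinate by a
-- permutation of Fin k are automorphisms, and together they move every edge onto the
-- edge α 0 0 0 ~ β 0 1 0. No automorphism sends α 0 0 0 to β 0 0 0: the k vertices
-- α 0 0 j all have the neighbourhood of α 0 0 0, but only the two vertices β t 0 0 have
-- the neighbourhood of β 0 0 0, so for k ≥ 3 the automorphism would identify two of them.
module Submission where

open import Defs hiding (sym)
open import Data.Bool using (Bool; true; false; not; if_then_else_)
open import Data.Fin using (Fin; zero; suc; combine; opposite; _↑ˡ_; _↑ʳ_)
open import Data.Fin.Patterns using (0F; 1F; 2F; 3F)
open import Data.Fin.Permutation
  using (Permutation′; _⟨$⟩ʳ_; _⟨$⟩ˡ_; transpose; flip; inverseˡ) renaming (id to idᵖ)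
open import Data.Fin.Properties using (_≟_; *↔×; remQuot-combine; pigeonhole; <⇒≢)
open import Data.List using (map; allFin; tabulate)
open import Data.List.Properties using (map-tabulate)
open import Data.Nat using (ℕ; zero; suc; _+_; _*_; _∸_; _≤_; s≤s; z≤n)
open import Data.Nat.ListAction using (sum)
open import Data.Nat.Properties using (+-0-commutativeMonoid; +-assoc; *-assoc; *-identityʳ)
open import Algebra.Properties.CommutativeMonoid.Sum +-0-commutativeMonoid
  using (sum-syntax; sum-cong-≗; sum-replicate-zero; ∑-comm)
open import Data.Product using (Σ; ∃; _×_; _,_; proj₁; proj₂)
open import Data.Product.Function.NonDependent.Propositional using (_×-↔_)
open import Data.Sum using (_⊎_; inj₁; inj₂)
open import Function using (_↔_; Inverse; mk↔ₛ′; mk⇔; _∘_; id)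
open import Function.Construct.Composition using (_↔-∘_)
open import Function.Construct.Identity using (↔-id)
open import Function.Construct.Symmetry using (↔-sym)
open import Relation.Binary.Construct.Closure.ReflexiveTransitive using (Star; ε; _◅_)
open import Relation.Binary.Construct.Closure.ReflexiveTransitive.Properties
  using (module StarReasoning)
open import Relation.Binary.PropositionalEquality
open import Relation.Nullary using (¬_; does; yes; no)
open import Relation.Nullary.Decidable using (dec-true; dec-false; does-⇔)

open Inverse using (to; from; strictlyInverseˡ; strictlyInverseʳ)

indicator : Bool → ℕ
indicator b = if b then 1 else 0

sum-map-allFin : ∀ n (f : Fin n → ℕ) → sum (map f (allFin n)) ≡ ∑[ i < n ] f i
sum-map-allFin n f = trans (cong sum (map-tabulate id f)) (sum-tabulate n)
  where
  sum-tabulate : ∀ n {g : Fin n → ℕ} → sum (tabulate g) ≡ ∑[ i < n ] g i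
  sum-tabulate zero        = refl
  sum-tabulate (suc n) {g} = cong (g zero +_) (sum-tabulate n)

∑-const : ∀ n c → ∑[ i < n ] c ≡ n * c
∑-const zero    c = refl
∑-const (suc n) c = cong (c +_) (∑-const n c)

∑-const-inner : ∀ m {n c} {g : Fin n → ℕ} →
                ∑[ j < n ] g j ≡ c → ∑[ i < m ] ∑[ j < n ] g j ≡ m * c
∑-const-inner m {c = c} eq = trans (sum-cong-≗ {m} (λ _ → eq)) (∑-const m c)

∑-+ : ∀ m n (f : Fin (m + n) → ℕ) →
      ∑[ i < m + n ] f i ≡ ∑[ i < m ] f (i ↑ˡ n) + ∑[ j < n ] f (m ↑ʳ j)
∑-+ zero    n f = refl
∑-+ (suc m) n f = trans (cong (f zero +_) (∑-+ m n (f ∘ suc))) (sym (+-assoc (f zero) _ _))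

∑-combine : ∀ m n (f : Fin (m * n) → ℕ) →
            ∑[ i < m * n ] f i ≡ ∑[ a < m ] ∑[ b < n ] f (combine a b)
∑-combine zero    n f = refl
∑-combine (suc m) n f = trans (∑-+ n (m * n) f)
  (cong (∑[ b < n ] f (b ↑ˡ (m * n)) +_) (∑-combine m n (f ∘ (n ↑ʳ_))))

∑-*↔× : ∀ m n (f : Fin m × Fin n → ℕ) →
        ∑[ i < m * n ] f (to *↔× i) ≡ ∑[ a < m ] ∑[ b < n ] f (a , b)
∑-*↔× m n f = trans (∑-combine m n _)
  (sum-cong-≗ λ a → sum-cong-≗ λ b → cong f (remQuot-combine a b))

_≢ᵇ_ : ∀ {n} → Fin n → Fin n → Bool
x ≢ᵇ y = not (does (x ≟ y))

∑-≢ᵇ : ∀ {n} (x : Fin n) → ∑[ y < n ] indicator (x ≢ᵇ y) ≡ n ∸ 1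
∑-≢ᵇ {suc n}       zero    = trans (∑-const n 1) (*-identityʳ n)
∑-≢ᵇ {suc (suc n)} (suc x) = cong suc (∑-≢ᵇ x)

≢ᵇ-sym : ∀ {n} (x y : Fin n) → x ≢ᵇ y ≡ y ≢ᵇ x
≢ᵇ-sym x y = cong not (does-⇔ (mk⇔ sym sym) (x ≟ y) (y ≟ x))

≢ᵇ-permute : ∀ {n} (π : Permutation′ n) (x y : Fin n) → (π ⟨$⟩ʳ x) ≢ᵇ (π ⟨$⟩ʳ y) ≡ x ≢ᵇ y
≢ᵇ-permute π x y = cong not (does-⇔ (mk⇔ injective (cong (π ⟨$⟩ʳ_))) (π ⟨$⟩ʳ x ≟ π ⟨$⟩ʳ y) (x ≟ y))
  where
  injective : π ⟨$⟩ʳ x ≡ π ⟨$⟩ʳ y → x ≡ y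
  injective eq = trans (sym (inverseˡ π)) (trans (cong (π ⟨$⟩ˡ_) eq) (inverseˡ π))

≢ᵇ⇒≢ : ∀ {n} {x y : Fin n} → x ≢ᵇ y ≡ true → ¬ x ≡ y
≢ᵇ⇒≢ {x = x} x≢ᵇx refl with () ← trans (sym (cong not (dec-true (x ≟ x) refl))) x≢ᵇx

≢ᵇ≡false⇒≡ : ∀ {n} {x y : Fin n} → x ≢ᵇ y ≡ false → x ≡ y
≢ᵇ≡false⇒≡ {x = x} {y} eq with x ≟ y
... | yes x≡y = x≡y
... | no _ with () ← eq

transpose-matchˡ : ∀ {n} (i j : Fin n) → transpose i j ⟨$⟩ʳ i ≡ j
transpose-matchˡ i j rewrite dec-true (i ≟ i) refl = refl

transpose-other : ∀ {n} {i j k : Fin n} → ¬ k ≡ i → ¬ k ≡ j → transpose i j ⟨$⟩ʳ k ≡ k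
transpose-other {i = i} {j} {k} k≢i k≢j
  rewrite dec-false (k ≟ i) k≢i | dec-false (k ≟ j) k≢j = refl

module _ {n} {G : Graph n} where

  _++ʷ_ : ∀ {u v w} → Walk G u v → Walk G v w → Walk G u w
  here     ++ʷ q = q
  step e p ++ʷ q = step e (p ++ʷ q)

  reverseʷ : ∀ {u v} → Walk G u v → Walk G v u
  reverseʷ here               = here
  reverseʷ (step {u} {w} e p) = reverseʷ p ++ʷ step (trans (Graph.sym G w u) e) here

connected-via : ∀ {n} (G : Graph n) (h : Fin n) → (∀ u → Walk G u h) → Connected G
connected-via G h toHub u v = toHub u ++ʷ reverseʷ (toHub v)

module Automorphisms {V : Set} (_~_ : V → V → Bool) where

  record Automorphism : Set where
    field
      bijection : V ↔ V
      preserves : ∀ u v → to bijection u ~ to bijection v ≡ u ~ v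

  open Automorphism public

  infixr 30 _⟨$⟩_
  _⟨$⟩_ : Automorphism → V → V
  φ ⟨$⟩ v = to (bijection φ) v

  automorphism : (h h⁻¹ : V → V) → (∀ v → h (h⁻¹ v) ≡ v) → (∀ v → h⁻¹ (h v) ≡ v) →
                 (∀ u v → h u ~ h v ≡ u ~ v) → Automorphism
  automorphism h h⁻¹ inv₁ inv₂ pres = record { bijection = mk↔ₛ′ h h⁻¹ inv₁ inv₂ ; preserves = pres }

  infixr 9 _∘ᴬ_
  _∘ᴬ_ : Automorphism → Automorphism → Automorphism
  ψ ∘ᴬ φ = record
    { bijection = bijection ψ ↔-∘ bijection φ
    ; preserves = λ u v → trans (preserves ψ (φ ⟨$⟩ u) (φ ⟨$⟩ v)) (preserves φ u v)
    }

  _⁻¹ᴬ : Automorphism → Automorphism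
  φ ⁻¹ᴬ = record
    { bijection = ↔-sym (bijection φ)
    ; preserves = λ u v → trans (sym (preserves φ _ _))
        (cong₂ _~_ (strictlyInverseˡ (bijection φ) u) (strictlyInverseˡ (bijection φ) v))
    }

  ⟨$⟩-injective : ∀ φ {u v} → φ ⟨$⟩ u ≡ φ ⟨$⟩ v → u ≡ v
  ⟨$⟩-injective φ {u} {v} eq = trans (sym (strictlyInverseʳ (bijection φ) u))
    (trans (cong (from (bijection φ)) eq) (strictlyInverseʳ (bijection φ) v))

  infix 4 _⇝_
  _⇝_ : V × V → V × V → Set
  (u , v) ⇝ (x , y) = Σ Automorphism λ φ → φ ⟨$⟩ u ≡ x × φ ⟨$⟩ v ≡ y

  ⇝-trans : ∀ {a b c} → a ⇝ b → b ⇝ c → a ⇝ c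
  ⇝-trans (φ , refl , refl) (ψ , refl , refl) = ψ ∘ᴬ φ , refl , refl

  ⇝-sym : ∀ {a b} → a ⇝ b → b ⇝ a
  ⇝-sym (φ , refl , refl) =
    φ ⁻¹ᴬ , strictlyInverseʳ (bijection φ) _ , strictlyInverseʳ (bijection φ) _

  Twins : V → V → Set
  Twins u w = ∀ z → u ~ z ≡ w ~ z

  Twins-image : ∀ φ {u w} → Twins u w → Twins (φ ⟨$⟩ u) (φ ⟨$⟩ w)
  Twins-image φ {u} {w} twins z = begin
    φ ⟨$⟩ u ~ z             ≡⟨ cong (φ ⟨$⟩ u ~_) (sym φz′≡z) ⟩
    φ ⟨$⟩ u ~ φ ⟨$⟩ z′      ≡⟨ preserves φ u z′ ⟩
    u ~ z′                  ≡⟨ twins z′ ⟩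
    w ~ z′                  ≡⟨ sym (preserves φ w z′) ⟩
    φ ⟨$⟩ w ~ φ ⟨$⟩ z′      ≡⟨ cong (φ ⟨$⟩ w ~_) φz′≡z ⟩
    φ ⟨$⟩ w ~ z             ∎
    where
    open ≡-Reasoning
    z′ = from (bijection φ) z
    φz′≡z : φ ⟨$⟩ z′ ≡ z
    φz′≡z = strictlyInverseˡ (bijection φ) z

module Induced {n} {V : Set} (e : Fin n ↔ V) (_~_ : V → V → Bool)
               (~-sym : ∀ u v → u ~ v ≡ v ~ u) (~-irrefl : ∀ v → v ~ v ≡ false) where

  open Automorphisms _~_

  graph : Graph n
  graph = record
    { adj   = λ i j → to e i ~ to e j
    ; sym   = λ i j → ~-sym (to e i) (to e j)
    ; irref = λ i → ~-irrefl (to e i)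
    }

  degree≡∑ : ∀ i → degree graph i ≡ ∑[ j < n ] indicator (to e i ~ to e j)
  degree≡∑ i = sum-map-allFin n _

  to-from : ∀ v → to e (from e v) ≡ v
  to-from = strictlyInverseˡ e

  toPermutation : Automorphism → Permutation′ n
  toPermutation φ = ↔-sym e ↔-∘ (bijection φ ↔-∘ e)

  toPermutation-isAutomorphism : ∀ φ → IsAutomorphism graph (toPermutation φ)
  toPermutation-isAutomorphism φ i j =
    trans (cong₂ _~_ (to-from _) (to-from _)) (preserves φ (to e i) (to e j))

  ⇝⇒automorphism : ∀ {i j x y} → (to e i , to e j) ⇝ (to e x , to e y) →
    Σ (Permutation′ n) λ σ → IsAutomorphism graph σ × σ ⟨$⟩ʳ i ≡ x × σ ⟨$⟩ʳ j ≡ y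
  ⇝⇒automorphism {x = x} {y} (φ , φi≡x , φj≡y) =
    toPermutation φ , toPermutation-isAutomorphism φ ,
    trans (cong (from e) φi≡x) (strictlyInverseʳ e x) ,
    trans (cong (from e) φj≡y) (strictlyInverseʳ e y)

  edgeTransitive-via : (base : V × V) →
    (∀ u v → u ~ v ≡ true → (u , v) ⇝ base ⊎ (v , u) ⇝ base) → EdgeTransitive graph
  edgeTransitive-via base toBase i j x y ij xy
    with toBase (to e i) (to e j) ij | toBase (to e x) (to e y) xy
  ... | inj₁ p | inj₁ q = let σ , aut , σi , σj = ⇝⇒automorphism (⇝-trans p (⇝-sym q))
                          in σ , aut , inj₁ (σi , σj)
  ... | inj₁ p | inj₂ q = let σ , aut , σi , σj = ⇝⇒automorphism (⇝-trans p (⇝-sym q))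
                          in σ , aut , inj₂ (σi , σj)
  ... | inj₂ p | inj₁ q = let σ , aut , σj , σi = ⇝⇒automorphism (⇝-trans p (⇝-sym q))
                          in σ , aut , inj₂ (σi , σj)
  ... | inj₂ p | inj₂ q = let σ , aut , σj , σi = ⇝⇒automorphism (⇝-trans p (⇝-sym q))
                          in σ , aut , inj₁ (σi , σj)

  fromPermutation : (σ : Permutation′ n) → IsAutomorphism graph σ → Automorphism
  fromPermutation σ aut = record
    { bijection = e ↔-∘ (σ ↔-∘ ↔-sym e)
    ; preserves = λ u v → trans (aut (from e u) (from e v)) (cong₂ _~_ (to-from u) (to-from v))
    }

  vertexTransitive⇒automorphism : VertexTransitive graph →
    ∀ u v → Σ Automorphism λ φ → φ ⟨$⟩ u ≡ v
  vertexTransitive⇒automorphism vt u v =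
    let σ , aut , σu≡v = vt (from e u) (from e v)
    in fromPermutation σ aut , trans (cong (to e) σu≡v) (to-from v)

  Adjacent : V → V → Set
  Adjacent u w = u ~ w ≡ true

  walk : ∀ {u t} → Star Adjacent u t → Walk graph (from e u) (from e t)
  walk ε        = here
  walk (uw ◅ p) = step (trans (cong₂ _~_ (to-from _) (to-from _)) uw) (walk p)

  connected-via-hub : (h : V) → (∀ v → Star Adjacent v h) → Connected graph
  connected-via-hub h toHub = connected-via graph (from e h) λ i →
    subst (λ i′ → Walk graph i′ (from e h)) (strictlyInverseʳ e i) (walk (toHub (to e i)))

module Construction (k : ℕ) where

  data Vertex : Set where
    α β : Fin 2 → Fin k → Fin k → Vertex

  coord : Fin 2 → Fin k → Fin k → Fin k
  coord 0F p q = p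
  coord 1F p q = q

  _~_ : Vertex → Vertex → Bool
  α s x _ ~ β _ p q = x ≢ᵇ coord s p q
  β _ p q ~ α s x _ = x ≢ᵇ coord s p q
  α _ _ _ ~ α _ _ _ = false
  β _ _ _ ~ β _ _ _ = false

  ~-sym : ∀ u v → u ~ v ≡ v ~ u
  ~-sym (α _ _ _) (α _ _ _) = refl
  ~-sym (α _ _ _) (β _ _ _) = refl
  ~-sym (β _ _ _) (α _ _ _) = refl
  ~-sym (β _ _ _) (β _ _ _) = refl

  ~-irrefl : ∀ v → v ~ v ≡ false
  ~-irrefl (α _ _ _) = refl
  ~-irrefl (β _ _ _) = refl

  vertex : Fin 4 × Fin k × Fin k → Vertex
  vertex (0F , x , y) = α 0F x y
  vertex (1F , x , y) = α 1F x y
  vertex (2F , x , y) = β 0F x y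
  vertex (3F , x , y) = β 1F x y

  label : Vertex → Fin 4 × Fin k × Fin k
  label (α 0F x y) = 0F , x , y
  label (α 1F x y) = 1F , x , y
  label (β 0F x y) = 2F , x , y
  label (β 1F x y) = 3F , x , y

  vertex-label : ∀ v → vertex (label v) ≡ v
  vertex-label (α 0F _ _) = refl
  vertex-label (α 1F _ _) = refl
  vertex-label (β 0F _ _) = refl
  vertex-label (β 1F _ _) = refl

  label-vertex : ∀ c → label (vertex c) ≡ c
  label-vertex (0F , _) = refl
  label-vertex (1F , _) = refl
  label-vertex (2F , _) = refl
  label-vertex (3F , _) = refl

  encoding : Fin (4 * (k * k)) ↔ Vertex
  encoding = mk↔ₛ′ vertex label vertex-label label-vertex ↔-∘ ((↔-id _ ×-↔ *↔×) ↔-∘ *↔×)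

  open Induced encoding _~_ ~-sym ~-irrefl public
  open Automorphisms _~_ public

  degree≡∑∑∑ : ∀ i → degree graph i ≡
    ∑[ c < 4 ] ∑[ p < k ] ∑[ q < k ] indicator (to encoding i ~ vertex (c , p , q))
  degree≡∑∑∑ i = trans (degree≡∑ i)
    (trans (∑-*↔× 4 (k * k) (λ (c , r) → adjacent (c , to *↔× r)))
           (sum-cong-≗ λ c → ∑-*↔× k k (λ pq → adjacent (c , pq))))
    where
    adjacent : Fin 4 × Fin k × Fin k → ℕ
    adjacent c = indicator (to encoding i ~ vertex c)

  ∑∑-coord : ∀ s x → ∑[ p < k ] ∑[ q < k ] indicator (x ≢ᵇ coord s p q) ≡ k * (k ∸ 1)
  ∑∑-coord 0F x = trans (∑-comm {k} {k} λ p q → indicator (x ≢ᵇ p)) (∑-const-inner k {k} (∑-≢ᵇ x))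
  ∑∑-coord 1F x = ∑-const-inner k {k} (∑-≢ᵇ x)

  ∑∑-copies : ∀ y → ∑[ x < k ] ∑[ i < k ] indicator (x ≢ᵇ y) ≡ k * (k ∸ 1)
  ∑∑-copies y = trans (∑-comm {k} {k} λ x i → indicator (x ≢ᵇ y))
    (∑-const-inner k {k} (trans (sum-cong-≗ λ x → cong indicator (≢ᵇ-sym x y)) (∑-≢ᵇ y)))

  ∑∑-zero : ∑[ p < k ] ∑[ q < k ] 0 ≡ 0
  ∑∑-zero = trans (sum-cong-≗ {k} λ _ → sum-replicate-zero k) (sum-replicate-zero k)

  ∑∑∑-neighbours : ∀ v →
    ∑[ c < 4 ] ∑[ p < k ] ∑[ q < k ] indicator (v ~ vertex (c , p , q)) ≡ 2 * (k * (k ∸ 1))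
  ∑∑∑-neighbours (α s x _) = cong₂ _+_ ∑∑-zero (cong₂ _+_ ∑∑-zero
    (cong₂ _+_ (∑∑-coord s x) (cong (_+ 0) (∑∑-coord s x))))
  ∑∑∑-neighbours (β _ p q) = cong₂ _+_ (∑∑-copies p) (cong₂ _+_ (∑∑-copies q)
    (cong₂ _+_ ∑∑-zero (cong (_+ 0) ∑∑-zero)))

  regular : Regular graph (2 * k * (k ∸ 1))
  regular i = trans (degree≡∑∑∑ i)
    (trans (∑∑∑-neighbours (to encoding i)) (sym (*-assoc 2 k (k ∸ 1))))

  swapSheets : Vertex → Vertex
  swapSheets (α s x i) = α (opposite s) x i
  swapSheets (β t p q) = β t q p

  swapSheets-involutive : ∀ v → swapSheets (swapSheets v) ≡ v
  swapSheets-involutive (α 0F _ _) = refl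
  swapSheets-involutive (α 1F _ _) = refl
  swapSheets-involutive (β _ _ _)  = refl

  swapSheets-preserves : ∀ u v → swapSheets u ~ swapSheets v ≡ u ~ v
  swapSheets-preserves (α _ _ _)  (α _ _ _)  = refl
  swapSheets-preserves (β _ _ _)  (β _ _ _)  = refl
  swapSheets-preserves (α 0F _ _) (β _ _ _)  = refl
  swapSheets-preserves (α 1F _ _) (β _ _ _)  = refl
  swapSheets-preserves (β _ _ _)  (α 0F _ _) = refl
  swapSheets-preserves (β _ _ _)  (α 1F _ _) = refl

  swapSheetsᴬ : Automorphism
  swapSheetsᴬ = automorphism swapSheets swapSheets
    swapSheets-involutive swapSheets-involutive swapSheets-preserves

  permuteCopies : Permutation′ k → Permutation′ 2 → Vertex → Vertex
  permuteCopies π τ (α s x i) = α s x (π ⟨$⟩ʳ i)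
  permuteCopies π τ (β t p q) = β (τ ⟨$⟩ʳ t) p q

  permuteCopies-inverse : ∀ π τ v → permuteCopies (flip π) (flip τ) (permuteCopies π τ v) ≡ v
  permuteCopies-inverse π τ (α s x i) = cong (α s x) (inverseˡ π)
  permuteCopies-inverse π τ (β t p q) = cong (λ t′ → β t′ p q) (inverseˡ τ)

  permuteCopies-preserves : ∀ π τ u v → permuteCopies π τ u ~ permuteCopies π τ v ≡ u ~ v
  permuteCopies-preserves π τ (α _ _ _) (α _ _ _) = refl
  permuteCopies-preserves π τ (α _ _ _) (β _ _ _) = refl
  permuteCopies-preserves π τ (β _ _ _) (α _ _ _) = refl
  permuteCopies-preserves π τ (β _ _ _) (β _ _ _) = refl

  permuteCopiesᴬ : Permutation′ k → Permutation′ 2 → Automorphism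
  permuteCopiesᴬ π τ = automorphism (permuteCopies π τ) (permuteCopies (flip π) (flip τ))
    (permuteCopies-inverse (flip π) (flip τ)) (permuteCopies-inverse π τ)
    (permuteCopies-preserves π τ)

  relabel : (Fin 2 → Permutation′ k) → Vertex → Vertex
  relabel ρ (α s x i) = α s (ρ s ⟨$⟩ʳ x) i
  relabel ρ (β t p q) = β t (ρ 0F ⟨$⟩ʳ p) (ρ 1F ⟨$⟩ʳ q)

  relabel-inverse : ∀ ρ v → relabel (flip ∘ ρ) (relabel ρ v) ≡ v
  relabel-inverse ρ (α s x i) = cong (λ x′ → α s x′ i) (inverseˡ (ρ s))
  relabel-inverse ρ (β t p q) = cong₂ (β t) (inverseˡ (ρ 0F)) (inverseˡ (ρ 1F))

  relabel-preserves : ∀ ρ u v → relabel ρ u ~ relabel ρ v ≡ u ~ v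
  relabel-preserves ρ (α _ _ _)  (α _ _ _)  = refl
  relabel-preserves ρ (β _ _ _)  (β _ _ _)  = refl
  relabel-preserves ρ (α 0F x _) (β _ p _)  = ≢ᵇ-permute (ρ 0F) x p
  relabel-preserves ρ (α 1F x _) (β _ _ q)  = ≢ᵇ-permute (ρ 1F) x q
  relabel-preserves ρ (β _ p _)  (α 0F x _) = ≢ᵇ-permute (ρ 0F) x p
  relabel-preserves ρ (β _ _ q)  (α 1F x _) = ≢ᵇ-permute (ρ 1F) x q

  relabelᴬ : (Fin 2 → Permutation′ k) → Automorphism
  relabelᴬ ρ = automorphism (relabel ρ) (relabel (flip ∘ ρ))
    (relabel-inverse (flip ∘ ρ)) (relabel-inverse ρ) (relabel-preserves ρ)

module EdgeTransitivity (m : ℕ) where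

  open Construction (2 + m)

  baseEdge : Vertex × Vertex
  baseEdge = α 0F 0F 0F , β 0F 1F 0F

  normal⇝base : ∀ {x p q} → x ≢ᵇ p ≡ true → (α 0F x 0F , β 0F p q) ⇝ baseEdge
  normal⇝base {x} {p} {q} x≢ᵇp =
    ⇝-trans (relabelᴬ ρ , cong (λ x′ → α 0F x′ 0F) (transpose-matchˡ x 0F)
                        , cong (β 0F p′) (transpose-matchˡ q 0F))
            (relabelᴬ ρ′ , cong (λ x′ → α 0F x′ 0F) (transpose-other 0≢p′ λ ())
                         , cong (λ p″ → β 0F p″ 0F) (transpose-matchˡ p′ 1F))
    where
    ρ ρ′ : Fin 2 → Permutation′ (2 + m)
    ρ 0F = transpose x 0F
    ρ 1F = transpose q 0F
    p′ = ρ 0F ⟨$⟩ʳ p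
    ρ′ 0F = transpose p′ 1F
    ρ′ 1F = idᵖ
    0≢p′ : ¬ 0F ≡ p′
    0≢p′ = ≢ᵇ⇒≢ (begin
      0F ≢ᵇ p′                        ≡⟨ cong (_≢ᵇ p′) (sym (transpose-matchˡ x 0F)) ⟩
      (ρ 0F ⟨$⟩ʳ x) ≢ᵇ (ρ 0F ⟨$⟩ʳ p)   ≡⟨ ≢ᵇ-permute (ρ 0F) x p ⟩
      x ≢ᵇ p                          ≡⟨ x≢ᵇp ⟩
      true                            ∎)
      where open ≡-Reasoning

  αβ⇝base : ∀ s x i t p q → x ≢ᵇ coord s p q ≡ true → (α s x i , β t p q) ⇝ baseEdge
  αβ⇝base 0F x i t p q adj =
    ⇝-trans (permuteCopiesᴬ (transpose i 0F) (transpose t 0F)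
              , cong (α 0F x) (transpose-matchˡ i 0F)
              , cong (λ t′ → β t′ p q) (transpose-matchˡ t 0F))
            (normal⇝base adj)
  αβ⇝base 1F x i t p q adj = ⇝-trans (swapSheetsᴬ , refl , refl) (αβ⇝base 0F x i t q p adj)

  edge⇝base : ∀ u v → u ~ v ≡ true → (u , v) ⇝ baseEdge ⊎ (v , u) ⇝ baseEdge
  edge⇝base (α s x i) (β t p q) adj = inj₁ (αβ⇝base s x i t p q adj)
  edge⇝base (β t p q) (α s x i) adj = inj₂ (αβ⇝base s x i t p q adj)

  edgeTransitive : EdgeTransitive graph
  edgeTransitive = edgeTransitive-via baseEdge edge⇝base

module AtLeastThree (m : ℕ) where

  open Construction (3 + m)

  avoiding : (x : Fin (3 + m)) → ∃ λ z → x ≢ᵇ z ≡ true × 0F ≢ᵇ z ≡ true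
  avoiding 0F            = 1F , refl , refl
  avoiding 1F            = 2F , refl , refl
  avoiding (suc (suc _)) = 1F , refl , refl

  hub : Vertex
  hub = α 0F 0F 0F

  α⟶hub : ∀ s x i → Star Adjacent (α s x i) hub
  α⟶hub s x i = begin
    α s x i    ⟶⟨ x≢ᵇcoord s ⟩
    β 0F z z   ⟶⟨ proj₂ (proj₂ (avoiding x)) ⟩
    hub        ∎
    where
    open StarReasoning Adjacent
    z = proj₁ (avoiding x)
    x≢ᵇcoord : ∀ s → x ≢ᵇ coord s z z ≡ true
    x≢ᵇcoord 0F = proj₁ (proj₂ (avoiding x))
    x≢ᵇcoord 1F = proj₁ (proj₂ (avoiding x))

  connected : Connected graph
  connected = connected-via-hub hub toHub
    where
    toHub : ∀ v → Star Adjacent v hub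
    toHub (α s x i) = α⟶hub s x i
    toHub (β t p q) = trans (≢ᵇ-sym z p) (proj₁ (proj₂ (avoiding p))) ◅ α⟶hub 0F z 0F
      where z = proj₁ (avoiding p)

  twins-α : ∀ j → Twins (α 0F 0F 0F) (α 0F 0F j)
  twins-α j (α _ _ _) = refl
  twins-α j (β _ _ _) = refl

  twins-β : ∀ {w} → Twins (β 0F 0F 0F) w → ∃ λ t → w ≡ β t 0F 0F
  twins-β {α _ _ _} twins with () ← twins (α 0F 1F 0F)
  twins-β {β t p q} twins = t , cong₂ (β t) (sym (≢ᵇ≡false⇒≡ (sym (twins (α 0F 0F 0F)))))
                                            (sym (≢ᵇ≡false⇒≡ (sym (twins (α 1F 0F 0F)))))

  α↛β : ∀ φ → ¬ φ ⟨$⟩ α 0F 0F 0F ≡ β 0F 0F 0F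
  α↛β φ φα≡β = <⇒≢ i<j (α-injective (⟨$⟩-injective φ (begin
    φ ⟨$⟩ α 0F 0F i              ≡⟨ proj₂ (sheet i) ⟩
    β (proj₁ (sheet i)) 0F 0F    ≡⟨ cong (λ t → β t 0F 0F) tᵢ≡tⱼ ⟩
    β (proj₁ (sheet j)) 0F 0F    ≡⟨ sym (proj₂ (sheet j)) ⟩
    φ ⟨$⟩ α 0F 0F j              ∎)))
    where
    open ≡-Reasoning
    sheet : ∀ j → ∃ λ t → φ ⟨$⟩ α 0F 0F j ≡ β t 0F 0F
    sheet j = twins-β (subst (λ w → Twins w (φ ⟨$⟩ α 0F 0F j)) φα≡β (Twins-image φ (twins-α j)))
    pigeon = pigeonhole (s≤s (s≤s (s≤s z≤n))) (proj₁ ∘ sheet)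
    i     = proj₁ pigeon
    j     = proj₁ (proj₂ pigeon)
    i<j   = proj₁ (proj₂ (proj₂ pigeon))
    tᵢ≡tⱼ = proj₂ (proj₂ (proj₂ pigeon))
    α-injective : ∀ {i j} → α 0F 0F i ≡ α 0F 0F j → i ≡ j
    α-injective refl = refl

  ¬vertexTransitive : ¬ VertexTransitive graph
  ¬vertexTransitive vt =
    let φ , φα≡β = vertexTransitive⇒automorphism vt (α 0F 0F 0F) (β 0F 0F 0F) in α↛β φ φα≡β

theorem6p1 : ∀ (k : ℕ) → 3 ≤ k →
    Σ (Graph (4 * (k * k))) λ G →
      Connected G × SemiSymmetric G × Regular G (2 * k * (k ∸ 1))
theorem6p1 (suc (suc (suc m))) (s≤s (s≤s (s≤s _))) =
  graph , connected , ((_ , regular) , edgeTransitive , ¬vertexTransitive) , regular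
  where
  open Construction (3 + m) using (graph; regular)
  open EdgeTransitivity (suc m) using (edgeTransitive)
  open AtLeastThree m using (connected; ¬vertexTransitive)
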